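{- For every digraph $D$, $\operatorname{dtw}(D)\geq\delta^*_c(D)$.
   Context: Cycle-degree: $d_c(v)$ is the minimum size of a set $S\subseteq V(D)\setminus\{v\}$ meeting every directed cycle containing $v$; $\delta^*_c(D)=\max_{H\subseteq D}\min_{v\in V(H)}d_c^H(v)$ over subdigraphs $H$. A directed tree-decomposition $(T,\mathcal{W},\mathcal{X})$ of $D=(V,A)$ consists of an out-arborescence $T=(I,F)$ rooted at $r$, a partition $\mathcal{W}=(W_t)_{t\in I}$ of $V$ into non-empty parts, and sets $\mathcal{X}=(X_e)_{e\in F}$ of vertices such that for every arc $tt'\in F$: (1) $X_{tt'}\cap\bigcup_{t''\in T_{t'}}W_{t''}=\emptyset$, where $T_{t'}$ is the subtree rooted at $t'$; (2) every directed walk with both ends in $\bigcup_{t''\in T_{t'}}W_{t''}$ and some internal vertex outside it meets $X_{tt'}$. Its width is $\max_{t\in I}|H_t|-1$ with $H_t=W_t\cup\bigcup_{e\in F,\,t\in e}X_e$; $\operatorname{dtw}(D)$ is the minimum width of a directed tree-decomposition of $D$. -}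

module Defs where

open import Data.Nat using (ℕ; zero; suc; _⊔_; _∸_; _≤_)
open import Data.Fin using (Fin; _≟_)
open import Data.Fin.Subset using (Subset; _∈_; _∉_; _⊆_; ∣_∣)
open import Data.Bool using (Bool; true; false; _∧_; _∨_)
open import Data.Vec using (tabulate; lookup)
open import Data.List using (List; []; _∷_; _++_; allFin; map; foldr)
open import Data.Bool.ListAction using (any)
open import Data.List.Relation.Unary.Any using (Any)
open import Data.List.Relation.Unary.Unique.Propositional using (Unique)
open import Data.List.Relation.Unary.Linked using (Linked)
open import Data.Product using (Σ; ∃; _×_)
open import Relation.Nullary using (¬_; does)
open import Relation.Binary.PropositionalEquality using (_≡_; _≢_)

-- Digraphs: finite vertex set Fin n, loopless arc relation
-- (parallel arcs are irrelevant for every notion used here).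

record Digraph : Set₁ where
  field
    n        : ℕ
    arc      : Fin n → Fin n → Set
    loopless : ∀ x → ¬ arc x x
open Digraph public

record Subdigraph (D : Digraph) : Set₁ where
  field
    verts   : Subset (n D)
    harc    : Fin (n D) → Fin (n D) → Set
    harc-ok : ∀ {x y} → harc x y → arc D x y × x ∈ verts × y ∈ verts
open Subdigraph public

NonEmpty : {D : Digraph} → Subdigraph D → Set
NonEmpty H = ∃ λ v → v ∈ verts H

-- Directed cycles of H through v: a sequence v , x₁ , … , xₖ , u of
-- pairwise distinct vertices (length ≥ 2) with consecutive arcs of H and
-- the closing arc u → v.

record CycleThrough {D : Digraph} (H : Subdigraph D) (v : Fin (n D)) : Set where
  field
    inner  : List (Fin (n D))
    last   : Fin (n D)
    distinct : Unique (v ∷ inner ++ last ∷ [])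
    path   : Linked (harc H) (v ∷ inner ++ last ∷ [])
    close  : harc H last v
open CycleThrough public

cycleVerts : {D : Digraph} {H : Subdigraph D} {v : Fin (n D)} →
             CycleThrough H v → List (Fin (n D))
cycleVerts {v = v} C = v ∷ inner C ++ last C ∷ []

CycleHitter : {D : Digraph} (H : Subdigraph D) (v : Fin (n D)) →
              Subset (n D) → Set
CycleHitter H v S =
  S ⊆ verts H × v ∉ S × (∀ (C : CycleThrough H v) → Any (_∈ S) (cycleVerts C))

IsCycleDegree : {D : Digraph} (H : Subdigraph D) (v : Fin (n D)) → ℕ → Set
IsCycleDegree H v k =
  (∃ λ S → CycleHitter H v S × ∣ S ∣ ≡ k) ×
  (∀ S → CycleHitter H v S → k ≤ ∣ S ∣)

IsMinCycleDegree : {D : Digraph} (H : Subdigraph D) → ℕ → Set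
IsMinCycleDegree H k =
  (∃ λ v → v ∈ verts H × IsCycleDegree H v k) ×
  (∀ v k' → v ∈ verts H → IsCycleDegree H v k' → k ≤ k')

IsDeltaStar : Digraph → ℕ → Set₁
IsDeltaStar D d =
  (Σ (Subdigraph D) λ H → NonEmpty H × IsMinCycleDegree H d) ×
  (∀ (H : Subdigraph D) k → NonEmpty H → IsMinCycleDegree H k → k ≤ d)

data Reach {m : ℕ} (F : Fin m → Fin m → Bool) : Fin m → Fin m → Set where
  here : ∀ {t} → Reach F t t
  step : ∀ {t u w} → F t u ≡ true → Reach F u w → Reach F t w

record DirTreeDec (D : Digraph) : Set where
  field
    -- the out-arborescence T = (I , F) with I = Fin m, rooted at root
    m          : ℕ
    F          : Fin m → Fin m → Bool
    root       : Fin m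
    root-noIn  : ∀ t → F t root ≡ false
    uniqueIn   : ∀ t' → t' ≢ root →
                 ∃ λ t → F t t' ≡ true × (∀ s → F s t' ≡ true → s ≡ t)
    reachable  : ∀ t → Reach F root t
    -- the partition W : vertex x lies in the part W_{β x}; parts non-empty
    β          : Fin (n D) → Fin m
    part-nonempty : ∀ t → ∃ λ x → β x ≡ t
    -- the sets X_{tt'} (only used when tt' ∈ F)
    X          : Fin m → Fin m → Subset (n D)
  -- x ∈ ⋃_{t'' ∈ T_{t'}} W_{t''}
  Below : Fin m → Fin (n D) → Set
  Below t' x = Reach F t' (β x)
  field
    cond1 : ∀ t t' → F t t' ≡ true → ∀ x → x ∈ X t t' → ¬ Below t' x
    cond2 : ∀ t t' → F t t' ≡ true → ∀ x ys y →
            Linked (arc D) (x ∷ ys ++ y ∷ []) →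
            Below t' x → Below t' y → Any (λ z → ¬ Below t' z) ys →
            Any (_∈ X t t') (x ∷ ys ++ y ∷ [])
open DirTreeDec public

-- H_t = W_t ∪ ⋃_{e ∈ F, t ∈ e} X_e
bag : {D : Digraph} (T : DirTreeDec D) → Fin (m T) → Subset (n D)
bag T t = tabulate λ x →
  does (β T x ≟ t) ∨
  any (λ s → (F T t s ∧ lookup (X T t s) x) ∨ (F T s t ∧ lookup (X T s t) x))
      (allFin (m T))

width : {D : Digraph} → DirTreeDec D → ℕ
width T = foldr _⊔_ 0 (map (λ t → ∣ bag T t ∣) (allFin (m T))) ∸ 1

IsDtw : Digraph → ℕ → Set
IsDtw D k = (∃ λ (T : DirTreeDec D) → width T ≡ k) ×
            (∀ (T : DirTreeDec D) → k ≤ width T)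

-- Take a subdigraph H realising δ*_c(D) and a vertex v of H whose part W_t
-- is lowest among the parts meeting V(H): every vertex of H in the subtree
-- T_t already lies in W_t. Then H_t ∖ {v}, restricted to V(H), meets every
-- cycle of H through v: either the cycle stays inside W_t ⊆ H_t, or it
-- leaves the subtree T_t and must return through X_{pt} ⊆ H_t, where p is
-- the parent of t. Hence δ*_c(D) ≤ d_c^H(v) ≤ |H_t| − 1 ≤ dtw(D).
-- The argument is classical (decidability of reachability in T, existence
-- of a minimum hitting set), which is harmless because d ≤ k is decidable.
module Submission where

open import Defs
open import Data.Nat using (ℕ; _≤_; _<_; _⊔_; _≤?_)
open import Data.Nat.Properties using (m≤m⊔n; m≤n⇒m≤o⊔n; ≮⇒≥; ∸-monoˡ-≤; <-≤-trans; module ≤-Reasoning)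
open import Data.Nat.Induction using (<-rec; <-wellFounded)
open import Data.Fin using (Fin; _≟_)
import Data.Fin as Fin
open import Data.Fin.Properties using (any?; sequence)
open import Data.Fin.Subset using (Subset; _∈_; _∉_; _⊂_; _∩_; _-_; ∣_∣)
open import Data.Fin.Subset.Properties
  using (_∈?_; x∈p∩q⁺; p∩q⊆p; p∩q⊆q; p─q⊆p; x∈p∧x≢y⇒x∈p-y; p⊂q⇒∣p∣<∣q∣)
open import Data.Bool using (Bool; true; T)
open import Data.Bool.Properties using (T-≡; T-∨; T-∧)
open import Data.Vec using (_∷_; tabulate)
import Data.Vec as Vec
open import Data.Vec.Properties using (lookup∘tabulate; lookup⇒[]=; []=⇒lookup)
open import Data.List using ([]; _∷_; _∷ʳ_; allFin; foldr)
open import Data.Bool.ListAction using (any)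
import Data.List.Membership.Propositional as List
open import Data.List.Membership.Propositional using (lose)
open import Data.List.Membership.Propositional.Properties using (∈-allFin; ∈-map⁺)
open import Data.List.Relation.Unary.Any as Any using (Any; here; there)
open import Data.List.Relation.Unary.Any.Properties using (++⁺ʳ; ++⁻; any⁺)
open import Data.List.Relation.Unary.All using (All; []; _∷_)
open import Data.List.Relation.Unary.All.Properties using (∷ʳ⁻)
open import Data.List.Relation.Unary.AllPairs using (_∷_)
open import Data.List.Relation.Unary.Linked as Linked using (Linked; [-]; _∷_)
open import Data.Product using (∃; _×_; _,_; proj₁; proj₂; uncurry)
open import Data.Sum using (_⊎_; inj₁; inj₂)
open import Effect.Monad using (RawMonad)
open import Function using (_∘_; _on_)
open import Function.Bundles using (module Equivalence)
open import Induction.WellFounded using (Acc; acc)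
open import Level using (0ℓ)
open import Relation.Binary.Construct.On as On using ()
open import Relation.Binary.PropositionalEquality using (_≡_; _≢_; refl; sym; trans; subst)
open import Relation.Nullary using (¬_; Dec; yes; no; ¬?; does; contradiction)
open import Relation.Nullary.Decidable using (decidable-stable; dec-true; _×-dec_; ¬¬-excluded-middle)
open import Relation.Nullary.Negation using (¬¬-Monad)

open RawMonad (¬¬-Monad {0ℓ})
open Equivalence using (to; from)

¬¬-least : ∀ {P : ℕ → Set} {n} → P n → ¬ ¬ ∃ λ j → P j × (∀ {i} → i < j → ¬ P i)
¬¬-least {P} {n} pn noLeast =
  <-rec (λ j → ¬ P j) (λ j smaller pj → noLeast (j , pj , smaller)) n pn

≤-foldr-⊔ : ∀ {x xs} → x List.∈ xs → x ≤ foldr _⊔_ 0 xs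
≤-foldr-⊔ (here refl) = m≤m⊔n _ _
≤-foldr-⊔ {xs = y ∷ _} (there x∈xs) = m≤n⇒m≤o⊔n y (≤-foldr-⊔ x∈xs)

module _ {A : Set} where

  Linked-∷ʳ⁺ : ∀ {R : A → A → Set} xs {a b} →
               Linked R (xs ∷ʳ a) → R a b → Linked R (xs ∷ʳ a ∷ʳ b)
  Linked-∷ʳ⁺ []           [-]       r = r ∷ [-]
  Linked-∷ʳ⁺ (_ ∷ [])     (h ∷ [-]) r = h ∷ r ∷ [-]
  Linked-∷ʳ⁺ (_ ∷ y ∷ xs) (h ∷ l)   r = h ∷ Linked-∷ʳ⁺ (y ∷ xs) l r

  Linked-All⁺ : ∀ {R : A → A → Set} {P : A → Set} → (∀ {x y} → R x y → P y) →
                ∀ {x xs} → P x → Linked R (x ∷ xs) → All P (x ∷ xs)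
  Linked-All⁺ R⇒P px [-]     = px ∷ []
  Linked-All⁺ R⇒P px (r ∷ l) = px ∷ Linked-All⁺ R⇒P (R⇒P r) l

  Any-∷ʳ⁻ : ∀ {P : A → Set} xs {a} → ¬ P a → Any P (xs ∷ʳ a) → Any P xs
  Any-∷ʳ⁻ xs ¬pa p with ++⁻ xs p
  ... | inj₁ pxs        = pxs
  ... | inj₂ (here pa)  = contradiction pa ¬pa

  All×Any⇒Any : ∀ {P Q : A → Set} {xs} → All P xs → Any Q xs → Any (λ x → P x × Q x) xs
  All×Any⇒Any (px ∷ _)   (here qx) = here (px , qx)
  All×Any⇒Any (_ ∷ pxs)  (there q) = there (All×Any⇒Any pxs q)

module _ {n : ℕ} where

  ∈-tabulate⁺ : ∀ (f : Fin n → Bool) {x} → T (f x) → x ∈ tabulate f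
  ∈-tabulate⁺ f {x} fx = lookup⇒[]= x (tabulate f) (trans (lookup∘tabulate f x) (to T-≡ fx))

  ∈-tabulate⁻ : ∀ (f : Fin n → Bool) {x} → x ∈ tabulate f → T (f x)
  ∈-tabulate⁻ f {x} x∈ = from T-≡ (trans (sym (lookup∘tabulate f x)) ([]=⇒lookup x∈))

x∉p-x : ∀ {n} (p : Subset n) x → x ∉ p - x
x∉p-x (_ ∷ _) Fin.zero    ()
x∉p-x (_ ∷ p) (Fin.suc x) (Vec.there x∈p-x) = x∉p-x p x x∈p-x

module _ {m : ℕ} {R : Fin m → Fin m → Bool} where

  Reach-trans : ∀ {a b c} → Reach R a b → Reach R b c → Reach R a c
  Reach-trans here       r′ = r′
  Reach-trans (step e r) r′ = step e (Reach-trans r r′)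

  Reach-last : ∀ {a b} → Reach R a b → a ≡ b ⊎ ∃ λ q → Reach R a q × R q b ≡ true
  Reach-last here = inj₁ refl
  Reach-last (step {t = a} e r) with Reach-last r
  ... | inj₁ refl             = inj₂ (a , here , e)
  ... | inj₂ (q , r′ , q→b)   = inj₂ (q , step e r′ , q→b)

module Arborescence {D : Digraph} (T : DirTreeDec D) where

  _↝_ : Fin (m T) → Fin (m T) → Set
  _↝_ = Reach (F T)

  ¬inArc-root : ∀ {s} → F T s (root T) ≢ true
  ¬inArc-root {s} s→r with trans (sym s→r) (root-noIn T s)
  ... | ()

  inArc-unique : ∀ {s s′ u} → F T s u ≡ true → F T s′ u ≡ true → s ≡ s′
  inArc-unique {s} {s′} {u} s→u s′→u with uniqueIn T u (λ { refl → ¬inArc-root s→u })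
  ... | (_ , _ , parent) = trans (parent s s→u) (sym (parent s′ s′→u))

  parent : ∀ t → t ≢ root T → ∃ λ p → F T p t ≡ true
  parent t t≢r with uniqueIn T t t≢r
  ... | (p , p→t , _) = p , p→t

  OnCycle : Fin (m T) → Set
  OnCycle u = ∃ λ w → F T u w ≡ true × w ↝ u

  -- A cycle entering u must do so through u's unique parent.
  OnCycle-parent : ∀ {p u} → F T p u ≡ true → OnCycle u → OnCycle p
  OnCycle-parent {u = u} p→u (w , u→w , w↝u) with Reach-last w↝u
  ... | inj₁ refl             = subst OnCycle (inArc-unique u→w p→u) (w , u→w , w↝u)
  ... | inj₂ (q , w↝q , q→u)  = subst OnCycle (inArc-unique q→u p→u) (u , q→u , step u→w w↝q)

  OnCycle-ancestor : ∀ {a b} → a ↝ b → OnCycle b → OnCycle a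
  OnCycle-ancestor here         c = c
  OnCycle-ancestor (step e a↝b) c = OnCycle-parent e (OnCycle-ancestor a↝b c)

  ¬OnCycle-root : ¬ OnCycle (root T)
  ¬OnCycle-root (w , r→w , w↝r) with Reach-last w↝r
  ... | inj₁ refl           = ¬inArc-root r→w
  ... | inj₂ (_ , _ , q→r)  = ¬inArc-root q→r

  ↝-antisym : ∀ {a b} → a ↝ b → b ↝ a → a ≡ b
  ↝-antisym here           _   = refl
  ↝-antisym {a} (step {u = u} a→u u↝b) b↝a =
    contradiction (OnCycle-ancestor (reachable T a) (u , a→u , Reach-trans u↝b b↝a)) ¬OnCycle-root

module Bags {D : Digraph} (T : DirTreeDec D) where

  W⊆bag : ∀ {x t} → β T x ≡ t → x ∈ bag T t
  W⊆bag {x} {t} βx≡t = ∈-tabulate⁺ _ (from T-∨ (inj₁ (from T-≡ (dec-true (β T x ≟ t) βx≡t))))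

  X⊆bag : ∀ {s t x} → F T s t ≡ true → x ∈ X T s t → x ∈ bag T t
  X⊆bag {s} {t} {x} s→t x∈X =
    ∈-tabulate⁺ _ (from T-∨ (inj₂ (any⁺ _ (lose (∈-allFin s)
      (from T-∨ (inj₂ (from T-∧ (from T-≡ s→t , from T-≡ ([]=⇒lookup x∈X)))))))))

  ⊂bag⇒∣∣≤width : ∀ {p t} → p ⊂ bag T t → ∣ p ∣ ≤ width T
  ⊂bag⇒∣∣≤width {t = t} p⊂bag =
    ∸-monoˡ-≤ 1 (<-≤-trans (p⊂q⇒∣p∣<∣q∣ p⊂bag) (≤-foldr-⊔ (∈-map⁺ (∣_∣ ∘ bag T) (∈-allFin t))))

module LowestPart {D : Digraph} (T : DirTreeDec D) (H : Subdigraph D)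
                  (_↝?_ : ∀ a b → Dec (Reach (F T) a b)) where

  open Arborescence T
  open Bags T

  descendants : Fin (m T) → Subset (m T)
  descendants t = tabulate (does ∘ (t ↝?_))

  ∈-descendants⁺ : ∀ {t s} → t ↝ s → s ∈ descendants t
  ∈-descendants⁺ {t} {s} t↝s = ∈-tabulate⁺ _ (from T-≡ (dec-true (t ↝? s) t↝s))

  ∈-descendants⁻ : ∀ {t s} → s ∈ descendants t → t ↝ s
  ∈-descendants⁻ {t} {s} s∈ with t ↝? s | ∈-tabulate⁻ (does ∘ (t ↝?_)) s∈
  ... | yes t↝s | _ = t↝s

  descendants-⊂ : ∀ {a b} → a ↝ b → a ≢ b → descendants b ⊂ descendants a
  descendants-⊂ a↝b a≢b =
    (λ s∈ → ∈-descendants⁺ (Reach-trans a↝b (∈-descendants⁻ s∈))) ,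
    _ , ∈-descendants⁺ here , (λ a∈ → a≢b (↝-antisym a↝b (∈-descendants⁻ a∈)))

  IsLowest : Fin (n D) → Set
  IsLowest v = ∀ {x} → x ∈ verts H → β T v ↝ β T x → β T x ≡ β T v

  _≺_ : Fin (n D) → Fin (n D) → Set
  _≺_ = _<_ on (∣_∣ ∘ descendants ∘ β T)

  lowest-below : ∀ {v} → v ∈ verts H → Acc _≺_ v → ∃ λ u → u ∈ verts H × IsLowest u
  lowest-below {v} v∈H (acc smaller)
    with any? (λ x → x ∈? verts H ×-dec (β T v ↝? β T x) ×-dec ¬? (β T x ≟ β T v))
  ... | yes (x , x∈H , v↝x , βx≢βv) =
        lowest-below x∈H (smaller (p⊂q⇒∣p∣<∣q∣ (descendants-⊂ v↝x (βx≢βv ∘ sym))))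
  ... | no none = v , v∈H , λ {x} x∈H v↝x →
        decidable-stable (β T x ≟ β T v) (λ βx≢βv → none (x , x∈H , v↝x , βx≢βv))

  lowest-exists : ∀ {v} → v ∈ verts H → ∃ λ u → u ∈ verts H × IsLowest u
  lowest-exists v∈H = lowest-below v∈H (On.wellFounded (∣_∣ ∘ descendants ∘ β T) <-wellFounded _)

  bagHitter : Fin (n D) → Subset (n D)
  bagHitter v = (verts H ∩ bag T (β T v)) - v

  ∈-bagHitter⁺ : ∀ {x v} → x ≢ v → x ∈ verts H → x ∈ bag T (β T v) → x ∈ bagHitter v
  ∈-bagHitter⁺ x≢v x∈H x∈bag = x∈p∧x≢y⇒x∈p-y (x∈p∩q⁺ (x∈H , x∈bag)) x≢v

  bagHitter⊂bag : ∀ v → bagHitter v ⊂ bag T (β T v)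
  bagHitter⊂bag v = p∩q⊆q _ _ ∘ p─q⊆p _ _ , v , W⊆bag refl , x∉p-x _ v

  lowest⇒hits : ∀ {v} → IsLowest v → (C : CycleThrough H v) → Any (_∈ bagHitter v) (cycleVerts C)
  lowest⇒hits {v} lowest C = by-last-vertex (β T v ↝? β T (last C))
    where
    t = β T v
    u = last C

    inH : All (_∈ verts H) (cycleVerts C)
    inH = Linked-All⁺ (λ h → proj₂ (proj₂ (harc-ok H h))) (proj₂ (proj₂ (harc-ok H (close C)))) (path C)

    u≢v : u ≢ v
    u≢v with distinct C
    ... | v∉rest ∷ _ = proj₂ (∷ʳ⁻ v∉rest) ∘ sym

    closedWalk : Linked (arc D) (cycleVerts C ∷ʳ v)
    closedWalk = Linked-∷ʳ⁺ (v ∷ inner C) (Linked.map (λ h → proj₁ (harc-ok H h)) (path C))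
                   (proj₁ (harc-ok H (close C)))

    -- Leaving T_t and coming back to v ∈ W_t forces the cycle through X_{pt}.
    through-X : ∀ {p} → F T p t ≡ true → ¬ t ↝ β T u → Any (_∈ bagHitter v) (cycleVerts C)
    through-X {p} p→t t↛u =
      Any.map (uncurry in-X) (All×Any⇒Any inH (Any-∷ʳ⁻ (cycleVerts C) v∉X walk-hits-X))
      where
      v∉X : v ∉ X T p t
      v∉X v∈X = cond1 T p t p→t v v∈X here
      walk-hits-X : Any (_∈ X T p t) (cycleVerts C ∷ʳ v)
      walk-hits-X = cond2 T p t p→t v (inner C ∷ʳ u) v closedWalk here here (++⁺ʳ (inner C) (here t↛u))
      in-X : ∀ {x} → x ∈ verts H → x ∈ X T p t → x ∈ bagHitter v
      in-X x∈H x∈X = ∈-bagHitter⁺ (λ { refl → v∉X x∈X }) x∈H (X⊆bag p→t x∈X)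

    by-last-vertex : Dec (t ↝ β T u) → Any (_∈ bagHitter v) (cycleVerts C)
    by-last-vertex (yes t↝u) = ++⁺ʳ (v ∷ inner C) (here (∈-bagHitter⁺ u≢v u∈H (W⊆bag (lowest u∈H t↝u))))
      where
      u∈H : u ∈ verts H
      u∈H = proj₂ (∷ʳ⁻ {xs = v ∷ inner C} inH)
    by-last-vertex (no t↛u) =
      through-X (proj₂ (parent t (λ { refl → t↛u (reachable T (β T u)) }))) t↛u

  lowest⇒CycleHitter : ∀ {v} → IsLowest v → CycleHitter H v (bagHitter v)
  lowest⇒CycleHitter {v} lowest = p∩q⊆p _ _ ∘ p─q⊆p _ _ , x∉p-x _ v , lowest⇒hits lowest

module _ {D : Digraph} (H : Subdigraph D) (v : Fin (n D)) where

  HitterOfSize : ℕ → Set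
  HitterOfSize j = ∃ λ S → CycleHitter H v S × ∣ S ∣ ≡ j

  least-size⇒≤hitters : ∀ {j} → (∀ {i} → i < j → ¬ HitterOfSize i) →
                        ∀ S → CycleHitter H v S → j ≤ ∣ S ∣
  least-size⇒≤hitters no-smaller S hitter = ≮⇒≥ (λ ∣S∣<j → no-smaller ∣S∣<j (S , hitter , refl))

  ¬¬-IsCycleDegree : ∀ {S} → CycleHitter H v S → ¬ ¬ ∃ λ j → IsCycleDegree H v j × j ≤ ∣ S ∣
  ¬¬-IsCycleDegree {S} hitter = do
    (j , hitter-of-size-j , no-smaller) ← ¬¬-least {P = HitterOfSize} (S , hitter , refl)
    let ≤hitters = least-size⇒≤hitters no-smaller
    pure (j , (hitter-of-size-j , ≤hitters) , ≤hitters S hitter)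

proposition20 : ∀ (D : Digraph) (k d : ℕ) → IsDtw D k → IsDeltaStar D d → d ≤ k
proposition20 D k d ((T , width≡k) , _) ((H , (v₀ , v₀∈H) , _ , δ*≤) , _) =
  decidable-stable (d ≤? k) do
    _↝?_ ← sequence rawApplicative λ a → sequence rawApplicative λ b → ¬¬-excluded-middle
    let open LowestPart T H _↝?_
    let (v , v∈H , lowest) = lowest-exists v₀∈H
    (j , degree , j≤) ← ¬¬-IsCycleDegree H v (lowest⇒CycleHitter lowest)
    pure (begin
      d                  ≤⟨ δ*≤ v j v∈H degree ⟩
      j                  ≤⟨ j≤ ⟩
      ∣ bagHitter v ∣    ≤⟨ Bags.⊂bag⇒∣∣≤width T (bagHitter⊂bag v) ⟩
      width T            ≡⟨ width≡k ⟩
      k                  ∎)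
  where open ≤-Reasoning
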